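{- Let $G$ be a graph with $\mathrm{Spec}(G)=A$. Then for every nonnegative integer $k$ there exists a graph $H$ with $\mathrm{Spec}(H)=\{x+k \mid x\in A\}$.
   Context: All graphs are finite and simple; all matchings considered are perfect matchings. For a perfect matching $M$ of a graph $G$, a forcing set for $M$ is a subset $S\subseteq M$ that is contained in no other perfect matching of $G$; the forcing number $f(G,M)$ is the minimum size of a forcing set for $M$. The spectrum of $G$ is $\mathrm{Spec}(G)=\{k \mid \text{there is a perfect matching } M \text{ of } G \text{ with } f(G,M)=k\}$. -}

module Defs where

open import Data.Nat using (ℕ; _≤_; _<ᵇ_)
open import Data.Bool using (Bool; true; false; _∧_; if_then_else_)
open import Data.Fin using (Fin; toℕ)
open import Data.List using (List; map; allFin)
open import Data.Nat.ListAction using (sum)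
open import Data.Product using (Σ; ∃; ∃-syntax; _×_)
open import Relation.Binary.PropositionalEquality using (_≡_)

record Graph : Set where
  field
    n     : ℕ
    adj   : Fin n → Fin n → Bool
    sym   : ∀ u v → adj u v ≡ adj v u
    irrfl : ∀ v → adj v v ≡ false

open Graph public

-- A set of (unordered) edges on Fin n, as a Boolean relation (required symmetric
-- where it matters).
EdgeSet : ℕ → Set
EdgeSet n = Fin n → Fin n → Bool

Symmetric : ∀ {n} → EdgeSet n → Set
Symmetric {n} S = ∀ (u v : Fin n) → S u v ≡ S v u

_⊆ₑ_ : ∀ {n} → EdgeSet n → EdgeSet n → Set
_⊆ₑ_ {n} S T = ∀ (u v : Fin n) → S u v ≡ true → T u v ≡ true

IsPerfectMatching : (G : Graph) → EdgeSet (n G) → Set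
IsPerfectMatching G M =
  Symmetric M × (M ⊆ₑ adj G) ×
  (∀ u → ∃[ v ] (M u v ≡ true × (∀ w → M u w ≡ true → w ≡ v)))

edgeCount : ∀ {n} → EdgeSet n → ℕ
edgeCount {n} S =
  sum (map (λ u → sum (map (λ v → if (toℕ u <ᵇ toℕ v) ∧ S u v then 1 else 0)
                           (allFin n)))
           (allFin n))

IsForcingSet : (G : Graph) → EdgeSet (n G) → EdgeSet (n G) → Set
IsForcingSet G M S =
  Symmetric S × (S ⊆ₑ M) ×
  (∀ M' → IsPerfectMatching G M' → S ⊆ₑ M' → ∀ u v → M' u v ≡ M u v)

ForcingNumber : (G : Graph) → EdgeSet (n G) → ℕ → Set
ForcingNumber G M k =
  (∃[ S ] (IsForcingSet G M S × edgeCount S ≡ k)) ×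
  (∀ S → IsForcingSet G M S → k ≤ edgeCount S)

InSpec : Graph → ℕ → Set
InSpec G k = ∃[ M ] (IsPerfectMatching G M × ForcingNumber G M k)

-- Perfect matchings and forcing sets of a disjoint union G ⊕ H split into those of G and
-- of H, and edge counts add up, so f(G ⊕ H, M ⊕ N) = f(G, M) + f(H, N) and
-- Spec(G ⊕ H) = Spec(G) + Spec(H).  The 4-cycle has exactly two perfect matchings, each
-- forced by any one of its edges, so Spec(C₄) = {1}; adding k copies of C₄ to G shifts
-- its spectrum by k.
module Submission where

open import Defs
open import Data.Bool using (Bool; true; false; _∧_; _∨_; _xor_; if_then_else_)
open import Data.Bool.Properties using (∧-zeroʳ; ∨-comm; ¬-not; xor-comm; xor-same; T-≡)
open import Data.Fin using (Fin; toℕ; _↑ˡ_; _↑ʳ_; splitAt; join; _≟_; _<_)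
import Data.Fin as Fin
open import Data.Fin.Patterns using (0F; 1F; 2F; 3F)
open import Data.Fin.Properties using (toℕ-↑ˡ; toℕ-↑ʳ; splitAt-join; join-splitAt; +↔⊎; <-cmp)
open import Data.List using (tabulate; map; allFin)
open import Data.List.Properties using (map-tabulate; tabulate-cong)
open import Data.Nat using (ℕ; zero; suc; _+_; _≤_; _<ᵇ_)
open import Data.Nat.ListAction using (sum)
open import Data.Nat.Properties
  using (≤-antisym; +-assoc; +-identityʳ; +-suc; +-mono-≤; +-cancelˡ-≤; +-cancelʳ-≤;
         m+n≡0⇒m≡0; m+n≡0⇒n≡0; n≢0⇒n>0; <⇒<ᵇ; module ≤-Reasoning)
open import Data.Product using (∃₂; ∃-syntax; _×_; _,_; proj₁; proj₂)
open import Data.Sum using (_⊎_; inj₁; inj₂)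
open import Data.Sum.Properties using (inj₁-injective; inj₂-injective)
import Data.Sum as Sum
open import Function using (_∘_; case_of_)
open import Function.Bundles using (_⇔_; mk⇔; _↔_; Inverse; Equivalence)
open import Function.Properties.Inverse using (↔-sym)
open import Relation.Binary using (tri<; tri≈; tri>)
open import Relation.Binary.PropositionalEquality
  using (_≡_; _≢_; _≗_; refl; trans; cong; cong₂; subst; subst₂; module ≡-Reasoning)
  renaming (sym to ≡-sym)
open import Relation.Nullary using (yes; no; contradiction)
open import Relation.Nullary.Decidable using (⌊_⌋)

private variable
  k l : ℕ
  A B : Set

_≗ₑ_ : (A → A → Bool) → (A → A → Bool) → Set
R ≗ₑ R′ = ∀ u v → R u v ≡ R′ u v

≗ₑ-sym : {R R′ : A → A → Bool} → R ≗ₑ R′ → R′ ≗ₑ R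
≗ₑ-sym R≗R′ u v = ≡-sym (R≗R′ u v)

≗ₑ-trans : {R R′ R″ : A → A → Bool} → R ≗ₑ R′ → R′ ≗ₑ R″ → R ≗ₑ R″
≗ₑ-trans R≗R′ R′≗R″ u v = trans (R≗R′ u v) (R′≗R″ u v)

⊆ₑ-false : {S T : EdgeSet k} → S ⊆ₑ T → ∀ {u v} → T u v ≡ false → S u v ≡ false
⊆ₑ-false S⊆T {u} {v} Tuv≡false =
  ¬-not λ Suv → contradiction (trans (≡-sym Tuv≡false) (S⊆T u v Suv)) λ ()

Perfect : (A → A → Bool) → Set
Perfect {A} R = ∀ (u : A) → ∃[ v ] (R u v ≡ true × (∀ w → R u w ≡ true → w ≡ v))

Perfect-resp : {R R′ : A → A → Bool} → R ≗ₑ R′ → Perfect R → Perfect R′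
Perfect-resp R≗R′ perfect u with perfect u
... | v , Ruv , unique =
  v , trans (≡-sym (R≗R′ u v)) Ruv , λ w R′uw → unique w (trans (R≗R′ u w) R′uw)

Perfect-relabel : {R : B → B → Bool} (e : A ↔ B) →
                  Perfect R → Perfect (λ x y → R (Inverse.to e x) (Inverse.to e y))
Perfect-relabel {R = R} e perfect x with perfect (Inverse.to e x)
... | v , Rxv , unique =
  from v , subst (λ w → R (to x) w ≡ true) (≡-sym (strictlyInverseˡ v)) Rxv ,
  λ w Rxw → trans (≡-sym (strictlyInverseʳ w)) (cong from (unique (to w) Rxw))
  where open Inverse e

∑ : (Fin k → ℕ) → ℕ
∑ f = sum (tabulate f)

∑-cong : {f g : Fin k → ℕ} → f ≗ g → ∑ f ≡ ∑ g
∑-cong f≗g = cong sum (tabulate-cong f≗g)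

∑-zero : {f : Fin k → ℕ} → (∀ i → f i ≡ 0) → ∑ f ≡ 0
∑-zero {zero}  f≡0 = refl
∑-zero {suc k} f≡0 = cong₂ _+_ (f≡0 0F) (∑-zero (f≡0 ∘ Fin.suc))

∑≡0⇒ : (f : Fin k → ℕ) → ∑ f ≡ 0 → ∀ i → f i ≡ 0
∑≡0⇒ f ∑f≡0 0F          = m+n≡0⇒m≡0 (f 0F) ∑f≡0
∑≡0⇒ f ∑f≡0 (Fin.suc i) = ∑≡0⇒ (f ∘ Fin.suc) (m+n≡0⇒n≡0 (f 0F) ∑f≡0) i

∑-+ : (f : Fin (k + l) → ℕ) → ∑ f ≡ ∑ (f ∘ (_↑ˡ l)) + ∑ (f ∘ (k ↑ʳ_))
∑-+ {zero}  f = refl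
∑-+ {suc k} {l} f = trans (cong (f 0F +_) (∑-+ {k} {l} (f ∘ Fin.suc))) (≡-sym (+-assoc (f 0F) _ _))

bit : Bool → ℕ
bit b = if b then 1 else 0

edgeIndicator : EdgeSet k → Fin k → Fin k → ℕ
edgeIndicator S u v = bit ((toℕ u <ᵇ toℕ v) ∧ S u v)

bit-∧-cong : ∀ {o o′ e e′} → o ≡ o′ → e ≡ e′ → bit (o ∧ e) ≡ bit (o′ ∧ e′)
bit-∧-cong = cong₂ (λ o e → bit (o ∧ e))

edgeCount-∑ : (S : EdgeSet k) → edgeCount S ≡ ∑ λ u → ∑ (edgeIndicator S u)
edgeCount-∑ {k} S =
  trans (sum-map-allFin λ u → sum (map (edgeIndicator S u) (allFin k)))
        (∑-cong λ u → sum-map-allFin (edgeIndicator S u))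
  where
  sum-map-allFin : (f : Fin k → ℕ) → sum (map f (allFin k)) ≡ ∑ f
  sum-map-allFin f = cong sum (map-tabulate (λ i → i) f)

edgeCount-resp : {S T : EdgeSet k} → S ≗ₑ T → edgeCount S ≡ edgeCount T
edgeCount-resp {S = S} {T} S≗T = begin
  edgeCount S                      ≡⟨ edgeCount-∑ S ⟩
  ∑ (λ u → ∑ (edgeIndicator S u))  ≡⟨ ∑-cong (λ u → ∑-cong λ v → bit-∧-cong refl (S≗T u v)) ⟩
  ∑ (λ u → ∑ (edgeIndicator T u))  ≡⟨ edgeCount-∑ T ⟨
  edgeCount T                      ∎
  where open ≡-Reasoning

edgeCount≡0⇒empty : {S : EdgeSet k} → Symmetric S → (∀ u → S u u ≡ false) →
                    edgeCount S ≡ 0 → ∀ u v → S u v ≡ false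
edgeCount≡0⇒empty {S = S} symmetric irreflexive count≡0 u v = ¬-not absent
  where
  indicator≡0 : ∀ u v → edgeIndicator S u v ≡ 0
  indicator≡0 u = ∑≡0⇒ _ (∑≡0⇒ _ (trans (≡-sym (edgeCount-∑ S)) count≡0) u)

  absent-below : ∀ {u v} → u < v → S u v ≢ true
  absent-below {u} {v} u<v Suv = contradiction counted λ ()
    where
    counted : 1 ≡ 0
    counted = trans (bit-∧-cong (≡-sym (Equivalence.to T-≡ (<⇒<ᵇ u<v))) (≡-sym Suv))
                    (indicator≡0 u v)

  absent : S u v ≢ true
  absent Suv with <-cmp u v
  ... | tri< u<v _ _ = absent-below u<v Suv
  ... | tri≈ _ refl _ = contradiction (trans (≡-sym (irreflexive u)) Suv) λ ()
  ... | tri> _ _ v<u = absent-below v<u (trans (symmetric v u) Suv)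

module _ {G : Graph} where

  isForcingSet-resp : {M M′ S : EdgeSet (n G)} → M ≗ₑ M′ → IsForcingSet G M S → IsForcingSet G M′ S
  isForcingSet-resp M≗M′ (symmetric , S⊆M , forced) =
    symmetric , (λ u v Suv → trans (≡-sym (M≗M′ u v)) (S⊆M u v Suv)) ,
    λ N pm S⊆N → ≗ₑ-trans (forced N pm S⊆N) M≗M′

  forcingNumber-resp : ∀ {M M′ f} → M ≗ₑ M′ → ForcingNumber G M f → ForcingNumber G M′ f
  forcingNumber-resp M≗M′ ((S , forcing , count) , minimal) =
    (S , isForcingSet-resp M≗M′ forcing , count) ,
    λ T forcingT → minimal T (isForcingSet-resp (≗ₑ-sym M≗M′) forcingT)

  forcingNumber-unique : ∀ {M f f′} → ForcingNumber G M f → ForcingNumber G M f′ → f ≡ f′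
  forcingNumber-unique ((S , forcingS , countS) , minimal) ((S′ , forcingS′ , countS′) , minimal′) =
    ≤-antisym (subst (_ ≤_) countS′ (minimal S′ forcingS′))
              (subst (_ ≤_) countS (minimal′ S forcingS))

  -- The empty set forces only the unique perfect matching, so a second perfect matching
  -- makes every forcing set nonempty.
  forcingNumber≡1 : ∀ {M M′ S u v} → IsPerfectMatching G M → IsPerfectMatching G M′ →
                    M′ u v ≢ M u v → IsForcingSet G M S → edgeCount S ≡ 1 → ForcingNumber G M 1
  forcingNumber≡1 {M} {M′} {S} {u} {v} pm pm′ M′≢M forcingS countS =
    (S , forcingS , countS) , λ T forcingT → n≢0⇒n>0 (nonempty forcingT)
    where
    nonempty : ∀ {T} → IsForcingSet G M T → edgeCount T ≢ 0
    nonempty {T} (symmetric , T⊆M , forced) count≡0 = M′≢M (forced M′ pm′ T⊆M′ u v)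
      where
      T⊆adj : T ⊆ₑ adj G
      T⊆adj x y Txy = proj₁ (proj₂ pm) x y (T⊆M x y Txy)
      empty : ∀ x y → T x y ≡ false
      empty = edgeCount≡0⇒empty symmetric (λ w → ⊆ₑ-false T⊆adj (irrfl G w)) count≡0
      T⊆M′ : T ⊆ₑ M′
      T⊆M′ x y Txy = contradiction (trans (≡-sym (empty x y)) Txy) λ ()

blocks : EdgeSet k → EdgeSet l → Fin k ⊎ Fin l → Fin k ⊎ Fin l → Bool
blocks S T (inj₁ a) (inj₁ b) = S a b
blocks S T (inj₁ a) (inj₂ b) = false
blocks S T (inj₂ a) (inj₁ b) = false
blocks S T (inj₂ a) (inj₂ b) = T a b

blocks-sym : {S : EdgeSet k} {T : EdgeSet l} → Symmetric S → Symmetric T →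
             ∀ x y → blocks S T x y ≡ blocks S T y x
blocks-sym symS symT (inj₁ a) (inj₁ b) = symS a b
blocks-sym symS symT (inj₁ a) (inj₂ b) = refl
blocks-sym symS symT (inj₂ a) (inj₁ b) = refl
blocks-sym symS symT (inj₂ a) (inj₂ b) = symT a b

blocks-⊆ : {S S′ : EdgeSet k} {T T′ : EdgeSet l} → S ⊆ₑ S′ → T ⊆ₑ T′ →
           ∀ x y → blocks S T x y ≡ true → blocks S′ T′ x y ≡ true
blocks-⊆ S⊆S′ T⊆T′ (inj₁ a) (inj₁ b) = S⊆S′ a b
blocks-⊆ S⊆S′ T⊆T′ (inj₂ a) (inj₂ b) = T⊆T′ a b

blocks-cong : {S S′ : EdgeSet k} {T T′ : EdgeSet l} → S ≗ₑ S′ → T ≗ₑ T′ → blocks S T ≗ₑ blocks S′ T′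
blocks-cong S≗S′ T≗T′ (inj₁ a) (inj₁ b) = S≗S′ a b
blocks-cong S≗S′ T≗T′ (inj₁ a) (inj₂ b) = refl
blocks-cong S≗S′ T≗T′ (inj₂ a) (inj₁ b) = refl
blocks-cong S≗S′ T≗T′ (inj₂ a) (inj₂ b) = T≗T′ a b

Perfect-blocks : {S : EdgeSet k} {T : EdgeSet l} → Perfect S → Perfect T → Perfect (blocks S T)
Perfect-blocks perfectS perfectT (inj₁ a) with perfectS a
... | b , Sab , unique = inj₁ b , Sab , λ { (inj₁ w) Saw → cong inj₁ (unique w Saw) }
Perfect-blocks perfectS perfectT (inj₂ a) with perfectT a
... | b , Tab , unique = inj₂ b , Tab , λ { (inj₂ w) Taw → cong inj₂ (unique w Taw) }

Perfect-blocks⁻ˡ : {S : EdgeSet k} {T : EdgeSet l} → Perfect (blocks S T) → Perfect S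
Perfect-blocks⁻ˡ perfect a with perfect (inj₁ a)
... | inj₁ b , Sab , unique = b , Sab , λ w Saw → inj₁-injective (unique (inj₁ w) Saw)

Perfect-blocks⁻ʳ : {S : EdgeSet k} {T : EdgeSet l} → Perfect (blocks S T) → Perfect T
Perfect-blocks⁻ʳ perfect a with perfect (inj₂ a)
... | inj₂ b , Tab , unique = b , Tab , λ w Taw → inj₂-injective (unique (inj₂ w) Taw)

+-cancelˡ-<ᵇ : ∀ m x y → (m + x <ᵇ m + y) ≡ (x <ᵇ y)
+-cancelˡ-<ᵇ zero    x y = refl
+-cancelˡ-<ᵇ (suc m) x y = +-cancelˡ-<ᵇ m x y

module DisjointSum {k l : ℕ} where

  _⊕ₑ_ : EdgeSet k → EdgeSet l → EdgeSet (k + l)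
  (S ⊕ₑ T) u v = blocks S T (splitAt k u) (splitAt k v)

  leftₑ : EdgeSet (k + l) → EdgeSet k
  leftₑ M a b = M (a ↑ˡ l) (b ↑ˡ l)

  rightₑ : EdgeSet (k + l) → EdgeSet l
  rightₑ M a b = M (k ↑ʳ a) (k ↑ʳ b)

  ⊕ₑ-join : (S : EdgeSet k) (T : EdgeSet l) →
            ∀ x y → (S ⊕ₑ T) (join k l x) (join k l y) ≡ blocks S T x y
  ⊕ₑ-join S T x y = cong₂ (blocks S T) (splitAt-join k l x) (splitAt-join k l y)

  leftₑ-⊕ₑ : (S : EdgeSet k) (T : EdgeSet l) → leftₑ (S ⊕ₑ T) ≗ₑ S
  leftₑ-⊕ₑ S T a b = ⊕ₑ-join S T (inj₁ a) (inj₁ b)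

  rightₑ-⊕ₑ : (S : EdgeSet k) (T : EdgeSet l) → rightₑ (S ⊕ₑ T) ≗ₑ T
  rightₑ-⊕ₑ S T a b = ⊕ₑ-join S T (inj₂ a) (inj₂ b)

  ⊕ₑ-sym : {S : EdgeSet k} {T : EdgeSet l} → Symmetric S → Symmetric T → Symmetric (S ⊕ₑ T)
  ⊕ₑ-sym symS symT u v = blocks-sym symS symT (splitAt k u) (splitAt k v)

  ⊕ₑ-⊆ : {S S′ : EdgeSet k} {T T′ : EdgeSet l} → S ⊆ₑ S′ → T ⊆ₑ T′ → (S ⊕ₑ T) ⊆ₑ (S′ ⊕ₑ T′)
  ⊕ₑ-⊆ S⊆S′ T⊆T′ u v = blocks-⊆ S⊆S′ T⊆T′ (splitAt k u) (splitAt k v)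

  ⊕ₑ-cong : {S S′ : EdgeSet k} {T T′ : EdgeSet l} → S ≗ₑ S′ → T ≗ₑ T′ → (S ⊕ₑ T) ≗ₑ (S′ ⊕ₑ T′)
  ⊕ₑ-cong S≗S′ T≗T′ u v = blocks-cong S≗S′ T≗T′ (splitAt k u) (splitAt k v)

  ≗ₑ-byBlocks : {M N : EdgeSet (k + l)} →
                (∀ x y → M (join k l x) (join k l y) ≡ N (join k l x) (join k l y)) → M ≗ₑ N
  ≗ₑ-byBlocks {M} {N} agree u v =
    subst₂ (λ u′ v′ → M u′ v′ ≡ N u′ v′) (join-splitAt k l u) (join-splitAt k l v)
           (agree (splitAt k u) (splitAt k v))

  ⊆-⊕ₑ⇒blocks : {M : EdgeSet (k + l)} {S : EdgeSet k} {T : EdgeSet l} → M ⊆ₑ (S ⊕ₑ T) →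
                ∀ x y → M (join k l x) (join k l y) ≡ blocks (leftₑ M) (rightₑ M) x y
  ⊆-⊕ₑ⇒blocks         M⊆S⊕T (inj₁ a) (inj₁ b) = refl
  ⊆-⊕ₑ⇒blocks {S = S} {T} M⊆S⊕T (inj₁ a) (inj₂ b) = ⊆ₑ-false M⊆S⊕T (⊕ₑ-join S T (inj₁ a) (inj₂ b))
  ⊆-⊕ₑ⇒blocks {S = S} {T} M⊆S⊕T (inj₂ a) (inj₁ b) = ⊆ₑ-false M⊆S⊕T (⊕ₑ-join S T (inj₂ a) (inj₁ b))
  ⊆-⊕ₑ⇒blocks         M⊆S⊕T (inj₂ a) (inj₂ b) = refl

  ⊆-⊕ₑ⇒≗ : {M : EdgeSet (k + l)} {S : EdgeSet k} {T : EdgeSet l} → M ⊆ₑ (S ⊕ₑ T) →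
           M ≗ₑ (leftₑ M ⊕ₑ rightₑ M)
  ⊆-⊕ₑ⇒≗ {M} M⊆S⊕T = ≗ₑ-byBlocks λ x y →
    trans (⊆-⊕ₑ⇒blocks M⊆S⊕T x y) (≡-sym (⊕ₑ-join (leftₑ M) (rightₑ M) x y))

  edgeCount-⊕ₑ : (S : EdgeSet k) (T : EdgeSet l) → edgeCount (S ⊕ₑ T) ≡ edgeCount S + edgeCount T
  edgeCount-⊕ₑ S T = begin
    edgeCount (S ⊕ₑ T)
      ≡⟨ edgeCount-∑ (S ⊕ₑ T) ⟩
    ∑ (λ u → ∑ (ι u))
      ≡⟨ ∑-+ {k} {l} _ ⟩
    ∑ (λ a → ∑ (ι (a ↑ˡ l))) + ∑ (λ b → ∑ (ι (k ↑ʳ b)))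
      ≡⟨ cong₂ _+_ (∑-cong leftRow) (∑-cong rightRow) ⟩
    ∑ (λ a → ∑ (edgeIndicator S a)) + ∑ (λ b → ∑ (edgeIndicator T b))
      ≡⟨ cong₂ _+_ (edgeCount-∑ S) (edgeCount-∑ T) ⟨
    edgeCount S + edgeCount T
      ∎
    where
    open ≡-Reasoning
    ι : Fin (k + l) → Fin (k + l) → ℕ
    ι = edgeIndicator (S ⊕ₑ T)

    cross : ∀ x y → blocks S T x y ≡ false → ι (join k l x) (join k l y) ≡ 0
    cross x y nonEdge =
      cong bit (trans (cong (_ ∧_) (trans (⊕ₑ-join S T x y) nonEdge)) (∧-zeroʳ _))

    leftRow : ∀ a → ∑ (ι (a ↑ˡ l)) ≡ ∑ (edgeIndicator S a)
    leftRow a = begin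
      ∑ (ι (a ↑ˡ l))                                              ≡⟨ ∑-+ {k} {l} _ ⟩
      ∑ (λ b → ι (a ↑ˡ l) (b ↑ˡ l)) + ∑ (λ b → ι (a ↑ˡ l) (k ↑ʳ b))
        ≡⟨ cong₂ _+_ (∑-cong λ b → bit-∧-cong (sameOrder b) (leftₑ-⊕ₑ S T a b))
                     (∑-zero λ b → cross (inj₁ a) (inj₂ b) refl) ⟩
      ∑ (edgeIndicator S a) + 0                                   ≡⟨ +-identityʳ _ ⟩
      ∑ (edgeIndicator S a)                                       ∎
      where
      sameOrder : ∀ b → (toℕ (a ↑ˡ l) <ᵇ toℕ (b ↑ˡ l)) ≡ (toℕ a <ᵇ toℕ b)
      sameOrder b = cong₂ _<ᵇ_ (toℕ-↑ˡ a l) (toℕ-↑ˡ b l)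

    rightRow : ∀ b → ∑ (ι (k ↑ʳ b)) ≡ ∑ (edgeIndicator T b)
    rightRow b = begin
      ∑ (ι (k ↑ʳ b))                                              ≡⟨ ∑-+ {k} {l} _ ⟩
      ∑ (λ a → ι (k ↑ʳ b) (a ↑ˡ l)) + ∑ (λ a → ι (k ↑ʳ b) (k ↑ʳ a))
        ≡⟨ cong₂ _+_ (∑-zero λ a → cross (inj₂ b) (inj₁ a) refl)
                     (∑-cong λ a → bit-∧-cong (sameOrder a) (rightₑ-⊕ₑ S T b a)) ⟩
      ∑ (edgeIndicator T b)                                       ∎
      where
      sameOrder : ∀ a → (toℕ (k ↑ʳ b) <ᵇ toℕ (k ↑ʳ a)) ≡ (toℕ b <ᵇ toℕ a)
      sameOrder a = trans (cong₂ _<ᵇ_ (toℕ-↑ʳ k b) (toℕ-↑ʳ k a)) (+-cancelˡ-<ᵇ k (toℕ b) (toℕ a))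

  edgeCount-split : {M : EdgeSet (k + l)} {S : EdgeSet k} {T : EdgeSet l} → M ⊆ₑ (S ⊕ₑ T) →
                    edgeCount M ≡ edgeCount (leftₑ M) + edgeCount (rightₑ M)
  edgeCount-split M⊆S⊕T = trans (edgeCount-resp (⊆-⊕ₑ⇒≗ M⊆S⊕T)) (edgeCount-⊕ₑ _ _)

_⊕_ : Graph → Graph → Graph
G ⊕ H = record
  { n     = n G + n H
  ; adj   = DisjointSum._⊕ₑ_ (adj G) (adj H)
  ; sym   = DisjointSum.⊕ₑ-sym (Graph.sym G) (Graph.sym H)
  ; irrfl = λ u → irreflexive (splitAt (n G) u)
  }
  where
  irreflexive : ∀ x → blocks (adj G) (adj H) x x ≡ false
  irreflexive (inj₁ a) = irrfl G a
  irreflexive (inj₂ a) = irrfl H a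

module _ {G H : Graph} where

  open DisjointSum {n G} {n H}

  ⊕ₑ-isPerfectMatching : ∀ {P Q} → IsPerfectMatching G P → IsPerfectMatching H Q →
                         IsPerfectMatching (G ⊕ H) (P ⊕ₑ Q)
  ⊕ₑ-isPerfectMatching (symP , P⊆adj , perfectP) (symQ , Q⊆adj , perfectQ) =
    ⊕ₑ-sym symP symQ , ⊕ₑ-⊆ P⊆adj Q⊆adj ,
    Perfect-relabel +↔⊎ (Perfect-blocks perfectP perfectQ)

  private
    perfect-blocks : ∀ {M} → IsPerfectMatching (G ⊕ H) M → Perfect (blocks (leftₑ M) (rightₑ M))
    perfect-blocks (_ , M⊆adj , perfect) =
      Perfect-resp (⊆-⊕ₑ⇒blocks M⊆adj) (Perfect-relabel (↔-sym +↔⊎) perfect)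

  leftₑ-isPerfectMatching : ∀ {M} → IsPerfectMatching (G ⊕ H) M → IsPerfectMatching G (leftₑ M)
  leftₑ-isPerfectMatching pm@(symM , M⊆adj , _) =
    (λ a b → symM _ _) ,
    (λ a b Mab → trans (≡-sym (leftₑ-⊕ₑ (adj G) (adj H) a b)) (M⊆adj _ _ Mab)) ,
    Perfect-blocks⁻ˡ (perfect-blocks pm)

  rightₑ-isPerfectMatching : ∀ {M} → IsPerfectMatching (G ⊕ H) M → IsPerfectMatching H (rightₑ M)
  rightₑ-isPerfectMatching pm@(symM , M⊆adj , _) =
    (λ a b → symM _ _) ,
    (λ a b Mab → trans (≡-sym (rightₑ-⊕ₑ (adj G) (adj H) a b)) (M⊆adj _ _ Mab)) ,
    Perfect-blocks⁻ʳ (perfect-blocks pm)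

  ⊕ₑ-isForcingSet : ∀ {P Q S T} → IsForcingSet G P S → IsForcingSet H Q T →
                    IsForcingSet (G ⊕ H) (P ⊕ₑ Q) (S ⊕ₑ T)
  ⊕ₑ-isForcingSet {P} {Q} {S} {T} (symS , S⊆P , forcedS) (symT , T⊆Q , forcedT) =
    ⊕ₑ-sym symS symT , ⊕ₑ-⊆ S⊆P T⊆Q , forced
    where
    forced : ∀ M → IsPerfectMatching (G ⊕ H) M → (S ⊕ₑ T) ⊆ₑ M → M ≗ₑ (P ⊕ₑ Q)
    forced M pm S⊕T⊆M = ≗ₑ-trans (⊆-⊕ₑ⇒≗ (proj₁ (proj₂ pm))) (⊕ₑ-cong
      (forcedS (leftₑ M)  (leftₑ-isPerfectMatching pm)  S⊆leftM)
      (forcedT (rightₑ M) (rightₑ-isPerfectMatching pm) T⊆rightM))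
      where
      S⊆leftM : S ⊆ₑ leftₑ M
      S⊆leftM a b Sab = S⊕T⊆M _ _ (trans (leftₑ-⊕ₑ S T a b) Sab)
      T⊆rightM : T ⊆ₑ rightₑ M
      T⊆rightM a b Tab = S⊕T⊆M _ _ (trans (rightₑ-⊕ₑ S T a b) Tab)

  module _ {P Q} (pmP : IsPerfectMatching G P) (pmQ : IsPerfectMatching H Q) where

    leftₑ-isForcingSet : ∀ {R} → IsForcingSet (G ⊕ H) (P ⊕ₑ Q) R → IsForcingSet G P (leftₑ R)
    leftₑ-isForcingSet {R} (symR , R⊆P⊕Q , forced) =
      (λ a b → symR _ _) ,
      (λ a b Rab → trans (≡-sym (leftₑ-⊕ₑ P Q a b)) (R⊆P⊕Q _ _ Rab)) ,
      forcedLeft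
      where
      forcedLeft : ∀ M → IsPerfectMatching G M → leftₑ R ⊆ₑ M → M ≗ₑ P
      forcedLeft M pm leftR⊆M a b = begin
        M a b                    ≡⟨ leftₑ-⊕ₑ M Q a b ⟨
        leftₑ (M ⊕ₑ Q) a b       ≡⟨ forced (M ⊕ₑ Q) (⊕ₑ-isPerfectMatching pm pmQ) R⊆M⊕Q _ _ ⟩
        leftₑ (P ⊕ₑ Q) a b       ≡⟨ leftₑ-⊕ₑ P Q a b ⟩
        P a b                    ∎
        where
        open ≡-Reasoning
        rightR⊆Q : rightₑ R ⊆ₑ Q
        rightR⊆Q a b Rab = trans (≡-sym (rightₑ-⊕ₑ P Q a b)) (R⊆P⊕Q _ _ Rab)
        R⊆M⊕Q : R ⊆ₑ (M ⊕ₑ Q)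
        R⊆M⊕Q u v Ruv = ⊕ₑ-⊆ leftR⊆M rightR⊆Q u v (trans (≡-sym (⊆-⊕ₑ⇒≗ R⊆P⊕Q u v)) Ruv)

    rightₑ-isForcingSet : ∀ {R} → IsForcingSet (G ⊕ H) (P ⊕ₑ Q) R → IsForcingSet H Q (rightₑ R)
    rightₑ-isForcingSet {R} (symR , R⊆P⊕Q , forced) =
      (λ a b → symR _ _) ,
      (λ a b Rab → trans (≡-sym (rightₑ-⊕ₑ P Q a b)) (R⊆P⊕Q _ _ Rab)) ,
      forcedRight
      where
      forcedRight : ∀ M → IsPerfectMatching H M → rightₑ R ⊆ₑ M → M ≗ₑ Q
      forcedRight M pm rightR⊆M a b = begin
        M a b                    ≡⟨ rightₑ-⊕ₑ P M a b ⟨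
        rightₑ (P ⊕ₑ M) a b      ≡⟨ forced (P ⊕ₑ M) (⊕ₑ-isPerfectMatching pmP pm) R⊆P⊕M _ _ ⟩
        rightₑ (P ⊕ₑ Q) a b      ≡⟨ rightₑ-⊕ₑ P Q a b ⟩
        Q a b                    ∎
        where
        open ≡-Reasoning
        leftR⊆P : leftₑ R ⊆ₑ P
        leftR⊆P a b Rab = trans (≡-sym (leftₑ-⊕ₑ P Q a b)) (R⊆P⊕Q _ _ Rab)
        R⊆P⊕M : R ⊆ₑ (P ⊕ₑ M)
        R⊆P⊕M u v Ruv = ⊕ₑ-⊆ leftR⊆P rightR⊆M u v (trans (≡-sym (⊆-⊕ₑ⇒≗ R⊆P⊕Q u v)) Ruv)

    ⊕ₑ-forcingNumber : ∀ {x y} → ForcingNumber G P x → ForcingNumber H Q y →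
                       ForcingNumber (G ⊕ H) (P ⊕ₑ Q) (x + y)
    ⊕ₑ-forcingNumber {x} {y} ((S , forcingS , countS) , minimalS)
                             ((T , forcingT , countT) , minimalT) =
      (S ⊕ₑ T , ⊕ₑ-isForcingSet forcingS forcingT ,
                trans (edgeCount-⊕ₑ S T) (cong₂ _+_ countS countT)) ,
      λ R forcingR → subst (x + y ≤_) (≡-sym (edgeCount-split (proj₁ (proj₂ forcingR))))
        (+-mono-≤ (minimalS _ (leftₑ-isForcingSet forcingR))
                  (minimalT _ (rightₑ-isForcingSet forcingR)))

    -- A minimum forcing set R of P ⊕ Q restricts to minimum forcing sets: a smaller one for P,
    -- put next to the right half of R, would beat R.
    ⊕ₑ-forcingNumber⁻ : ∀ {z} → ForcingNumber (G ⊕ H) (P ⊕ₑ Q) z →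
                        ∃₂ λ x y → ForcingNumber G P x × ForcingNumber H Q y × z ≡ x + y
    ⊕ₑ-forcingNumber⁻ {z} ((R , forcingR , countR) , minimalR) =
      x , y , ((leftₑ R , forcingL , refl) , minimalL) ,
              ((rightₑ R , forcingR′ , refl) , minimalR′) , z≡x+y
      where
      open ≤-Reasoning
      x y : ℕ
      x = edgeCount (leftₑ R)
      y = edgeCount (rightₑ R)

      forcingL : IsForcingSet G P (leftₑ R)
      forcingL = leftₑ-isForcingSet forcingR
      forcingR′ : IsForcingSet H Q (rightₑ R)
      forcingR′ = rightₑ-isForcingSet forcingR

      z≡x+y : z ≡ x + y
      z≡x+y = trans (≡-sym countR) (edgeCount-split (proj₁ (proj₂ forcingR)))

      minimalL : ∀ S → IsForcingSet G P S → x ≤ edgeCount S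
      minimalL S forcingS = +-cancelʳ-≤ y x (edgeCount S) (begin
        x + y                       ≡⟨ z≡x+y ⟨
        z                           ≤⟨ minimalR _ (⊕ₑ-isForcingSet forcingS forcingR′) ⟩
        edgeCount (S ⊕ₑ rightₑ R)   ≡⟨ edgeCount-⊕ₑ S (rightₑ R) ⟩
        edgeCount S + y             ∎)

      minimalR′ : ∀ T → IsForcingSet H Q T → y ≤ edgeCount T
      minimalR′ T forcingT = +-cancelˡ-≤ x y (edgeCount T) (begin
        x + y                       ≡⟨ z≡x+y ⟨
        z                           ≤⟨ minimalR _ (⊕ₑ-isForcingSet forcingL forcingT) ⟩
        edgeCount (leftₑ R ⊕ₑ T)    ≡⟨ edgeCount-⊕ₑ (leftₑ R) T ⟩
        x + edgeCount T             ∎)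

  inSpec-⊕ : ∀ z → InSpec (G ⊕ H) z ⇔ (∃₂ λ x y → InSpec G x × InSpec H y × z ≡ x + y)
  inSpec-⊕ z = mk⇔ split combine
    where
    split : InSpec (G ⊕ H) z → ∃₂ λ x y → InSpec G x × InSpec H y × z ≡ x + y
    split (M , pm , forcingNumber) =
      let x , y , fP , fQ , z≡x+y =
            ⊕ₑ-forcingNumber⁻ pmP pmQ (forcingNumber-resp {G = G ⊕ H} M≗P⊕Q forcingNumber)
      in  x , y , (leftₑ M , pmP , fP) , (rightₑ M , pmQ , fQ) , z≡x+y
      where
      pmP : IsPerfectMatching G (leftₑ M)
      pmP = leftₑ-isPerfectMatching pm
      pmQ : IsPerfectMatching H (rightₑ M)
      pmQ = rightₑ-isPerfectMatching pm
      M≗P⊕Q : M ≗ₑ (leftₑ M ⊕ₑ rightₑ M)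
      M≗P⊕Q = ⊆-⊕ₑ⇒≗ {S = adj G} {T = adj H} (proj₁ (proj₂ pm))

    combine : (∃₂ λ x y → InSpec G x × InSpec H y × z ≡ x + y) → InSpec (G ⊕ H) z
    combine (x , y , (P , pmP , fP) , (Q , pmQ , fQ) , refl) =
      P ⊕ₑ Q , ⊕ₑ-isPerfectMatching pmP pmQ , ⊕ₑ-forcingNumber pmP pmQ fP fQ

matchingOf : (Fin k → Fin k) → EdgeSet k
matchingOf π u v = ⌊ v ≟ π u ⌋

matchingOf-isPerfectMatching : (G : Graph) (π : Fin (n G) → Fin (n G)) →
  (∀ u → π (π u) ≡ u) → (∀ u → adj G u (π u) ≡ true) → IsPerfectMatching G (matchingOf π)
matchingOf-isPerfectMatching G π involutive adjacent = symmetric , ⊆adj , perfect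
  where
  symmetric : Symmetric (matchingOf π)
  symmetric u v with v ≟ π u | u ≟ π v
  ... | yes _    | yes _   = refl
  ... | no _     | no _    = refl
  ... | yes refl | no u≢   = contradiction (≡-sym (involutive u)) u≢
  ... | no v≢    | yes refl = contradiction (≡-sym (involutive v)) v≢

  ⊆adj : matchingOf π ⊆ₑ adj G
  ⊆adj u v with v ≟ π u
  ... | yes refl = λ _ → adjacent u
  ... | no _     = λ ()

  perfect : Perfect (matchingOf π)
  perfect u = π u , matched , unique
    where
    matched : matchingOf π u (π u) ≡ true
    matched with π u ≟ π u
    ... | yes _ = refl
    ... | no π≢π = contradiction refl π≢π
    unique : ∀ w → matchingOf π u w ≡ true → w ≡ π u
    unique w with w ≟ π u
    ... | yes w≡ = λ _ → w≡
    ... | no _   = λ ()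

module Partner {G : Graph} {M : EdgeSet (n G)} (pm : IsPerfectMatching G M) where

  partner : Fin (n G) → Fin (n G)
  partner u = proj₁ (proj₂ (proj₂ pm) u)

  partner-matched : ∀ u → M u (partner u) ≡ true
  partner-matched u = proj₁ (proj₂ (proj₂ (proj₂ pm) u))

  partner-unique : ∀ {u v} → M u v ≡ true → v ≡ partner u
  partner-unique {u} {v} = proj₂ (proj₂ (proj₂ (proj₂ pm) u)) v

  partner-adjacent : ∀ {u v} → partner u ≡ v → adj G u v ≡ true
  partner-adjacent {u} refl = proj₁ (proj₂ pm) u (partner u) (partner-matched u)

  partner-back : ∀ {u v} → partner u ≡ v → partner v ≡ u
  partner-back {u} refl =
    ≡-sym (partner-unique (trans (proj₁ pm (partner u) u) (partner-matched u)))

  ≗ₑ-partnerMatching : M ≗ₑ matchingOf partner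
  ≗ₑ-partnerMatching u v with v ≟ partner u
  ... | yes refl = partner-matched u
  ... | no v≢partner = ¬-not (v≢partner ∘ partner-unique)

matchingOf-cong : {π ρ : Fin k → Fin k} → π ≗ ρ → matchingOf π ≗ₑ matchingOf ρ
matchingOf-cong π≗ρ u v = cong (λ w → ⌊ v ≟ w ⌋) (π≗ρ u)

edgesAt : Fin k → EdgeSet k → EdgeSet k
edgesAt w S u v = S u v ∧ (⌊ u ≟ w ⌋ ∨ ⌊ v ≟ w ⌋)

edgesAt-sym : ∀ {w} {S : EdgeSet k} → Symmetric S → Symmetric (edgesAt w S)
edgesAt-sym {w = w} symS u v = cong₂ _∧_ (symS u v) (∨-comm ⌊ u ≟ w ⌋ ⌊ v ≟ w ⌋)

edgesAt-⊆ : ∀ {w} {S : EdgeSet k} → edgesAt w S ⊆ₑ S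
edgesAt-⊆ {S = S} u v with S u v
... | true  = λ _ → refl
... | false = λ ()

-- The sides of C₄ = K₂,₂ are the even and the odd vertices: 0 – 1 – 2 – 3 – 0.
side : Fin 4 → Bool
side 0F = false
side 1F = true
side 2F = false
side 3F = true

C₄ : Graph
C₄ = record
  { n     = 4
  ; adj   = λ u v → side u xor side v
  ; sym   = λ u v → xor-comm (side u) (side v)
  ; irrfl = λ u → xor-same (side u)
  }

open Partner {C₄}

pair₀₁ pair₀₃ : Fin 4 → Fin 4
pair₀₁ 0F = 1F
pair₀₁ 1F = 0F
pair₀₁ 2F = 3F
pair₀₁ 3F = 2F
pair₀₃ 0F = 3F
pair₀₃ 1F = 2F
pair₀₃ 2F = 1F
pair₀₃ 3F = 0F

M₀₁ M₀₃ : EdgeSet 4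
M₀₁ = matchingOf pair₀₁
M₀₃ = matchingOf pair₀₃

M₀₁-isPerfectMatching : IsPerfectMatching C₄ M₀₁
M₀₁-isPerfectMatching = matchingOf-isPerfectMatching C₄ pair₀₁
  (λ { 0F → refl ; 1F → refl ; 2F → refl ; 3F → refl })
  (λ { 0F → refl ; 1F → refl ; 2F → refl ; 3F → refl })

M₀₃-isPerfectMatching : IsPerfectMatching C₄ M₀₃
M₀₃-isPerfectMatching = matchingOf-isPerfectMatching C₄ pair₀₃
  (λ { 0F → refl ; 1F → refl ; 2F → refl ; 3F → refl })
  (λ { 0F → refl ; 1F → refl ; 2F → refl ; 3F → refl })

-- Vertices 0 and 2 each have the neighbours 1 and 3, and they cannot share a partner.
partner-C₄ : ∀ {M} (pm : IsPerfectMatching C₄ M) → partner pm ≗ pair₀₁ ⊎ partner pm ≗ pair₀₃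
partner-C₄ pm with partner pm 0F in p0 | partner pm 2F in p2
... | 1F | 3F = inj₁ λ { 0F → p0 ; 1F → partner-back pm p0 ; 2F → p2 ; 3F → partner-back pm p2 }
... | 3F | 1F = inj₂ λ { 0F → p0 ; 1F → partner-back pm p2 ; 2F → p2 ; 3F → partner-back pm p0 }
... | 1F | 1F = case trans (≡-sym (partner-back pm p0)) (partner-back pm p2) of λ ()
... | 3F | 3F = case trans (≡-sym (partner-back pm p0)) (partner-back pm p2) of λ ()
... | 0F | _  = case partner-adjacent pm p0 of λ ()
... | 2F | _  = case partner-adjacent pm p0 of λ ()
... | _  | 0F = case partner-adjacent pm p2 of λ ()
... | _  | 2F = case partner-adjacent pm p2 of λ ()

perfectMatching-C₄ : ∀ {M} → IsPerfectMatching C₄ M → M ≗ₑ M₀₁ ⊎ M ≗ₑ M₀₃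
perfectMatching-C₄ {M} pm = Sum.map asMatching asMatching (partner-C₄ pm)
  where
  asMatching : ∀ {π} → partner pm ≗ π → M ≗ₑ matchingOf π
  asMatching p≗π = ≗ₑ-trans (≗ₑ-partnerMatching pm) (matchingOf-cong p≗π)

forcingNumber-M₀₁ : ForcingNumber C₄ M₀₁ 1
forcingNumber-M₀₁ =
  forcingNumber≡1 {C₄} {u = 0F} {v = 1F} M₀₁-isPerfectMatching M₀₃-isPerfectMatching (λ ())
  (edgesAt-sym (proj₁ M₀₁-isPerfectMatching) , edgesAt-⊆ , forced) refl
  where
  forced : ∀ M → IsPerfectMatching C₄ M → edgesAt 0F M₀₁ ⊆ₑ M → M ≗ₑ M₀₁
  forced M pm edge⊆M with perfectMatching-C₄ pm
  ... | inj₁ M≗M₀₁ = M≗M₀₁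
  ... | inj₂ M≗M₀₃ = case trans (≡-sym (M≗M₀₃ 0F 1F)) (edge⊆M 0F 1F refl) of λ ()

forcingNumber-M₀₃ : ForcingNumber C₄ M₀₃ 1
forcingNumber-M₀₃ =
  forcingNumber≡1 {C₄} {u = 0F} {v = 3F} M₀₃-isPerfectMatching M₀₁-isPerfectMatching (λ ())
  (edgesAt-sym (proj₁ M₀₃-isPerfectMatching) , edgesAt-⊆ , forced) refl
  where
  forced : ∀ M → IsPerfectMatching C₄ M → edgesAt 0F M₀₃ ⊆ₑ M → M ≗ₑ M₀₃
  forced M pm edge⊆M with perfectMatching-C₄ pm
  ... | inj₁ M≗M₀₁ = case trans (≡-sym (M≗M₀₁ 0F 3F)) (edge⊆M 0F 3F refl) of λ ()
  ... | inj₂ M≗M₀₃ = M≗M₀₃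

inSpec-C₄ : ∀ y → InSpec C₄ y ⇔ y ≡ 1
inSpec-C₄ y = mk⇔ (λ (M , pm , f) → forcingNumber-unique {C₄} f (forcingNumber-C₄ pm))
                  (λ { refl → M₀₁ , M₀₁-isPerfectMatching , forcingNumber-M₀₁ })
  where
  forcingNumber-C₄ : ∀ {M} → IsPerfectMatching C₄ M → ForcingNumber C₄ M 1
  forcingNumber-C₄ pm with perfectMatching-C₄ pm
  ... | inj₁ M≗M₀₁ = forcingNumber-resp {C₄} (≗ₑ-sym M≗M₀₁) forcingNumber-M₀₁
  ... | inj₂ M≗M₀₃ = forcingNumber-resp {C₄} (≗ₑ-sym M≗M₀₃) forcingNumber-M₀₃

open Equivalence using (to; from)

inSpec-C₄⊕ : ∀ G y → InSpec (C₄ ⊕ G) y ⇔ (∃[ x ] (InSpec G x × y ≡ suc x))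
inSpec-C₄⊕ G y = mk⇔ drop add
  where
  drop : InSpec (C₄ ⊕ G) y → ∃[ x ] (InSpec G x × y ≡ suc x)
  drop inSpec with to (inSpec-⊕ {C₄} {G} y) inSpec
  ... | one , x , inSpecC₄ , inSpecG , y≡one+x =
    x , inSpecG , trans y≡one+x (cong (_+ x) (to (inSpec-C₄ one) inSpecC₄))

  add : ∃[ x ] (InSpec G x × y ≡ suc x) → InSpec (C₄ ⊕ G) y
  add (x , inSpecG , y≡1+x) =
    from (inSpec-⊕ {C₄} {G} y) (1 , x , from (inSpec-C₄ 1) refl , inSpecG , y≡1+x)

mainTheorem1 : (G : Graph) (k : ℕ) →
    ∃[ H ] (∀ (y : ℕ) → InSpec H y ⇔ (∃[ x ] (InSpec G x × y ≡ x + k)))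
mainTheorem1 G k = C₄ⁿ⊕G k , spectrum k
  where
  C₄ⁿ⊕G : ℕ → Graph
  C₄ⁿ⊕G zero    = G
  C₄ⁿ⊕G (suc k) = C₄ ⊕ C₄ⁿ⊕G k

  spectrum : ∀ k y → InSpec (C₄ⁿ⊕G k) y ⇔ (∃[ x ] (InSpec G x × y ≡ x + k))
  spectrum zero y = mk⇔
    (λ inSpec → y , inSpec , ≡-sym (+-identityʳ y))
    (λ (x , inSpec , y≡x+0) → subst (InSpec G) (≡-sym (trans y≡x+0 (+-identityʳ x))) inSpec)
  spectrum (suc k) y = mk⇔
    (λ inSpec → let x′ , inSpec′ , y≡1+x′ = to (inSpec-C₄⊕ (C₄ⁿ⊕G k) y) inSpec
                    x  , inSpecG , x′≡x+k = to (spectrum k x′) inSpec′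
                in  x , inSpecG , trans y≡1+x′ (trans (cong suc x′≡x+k) (≡-sym (+-suc x k))))
    (λ (x , inSpecG , y≡x+1+k) →
       from (inSpec-C₄⊕ (C₄ⁿ⊕G k) y)
            (x + k , from (spectrum k (x + k)) (x , inSpecG , refl) , trans y≡x+1+k (+-suc x k)))
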